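{- Let $G$ be a finite simple graph. Then $G$ is a proper color-line graph if and only if there exists a family $\mathcal{Q}$ of cliques of $G$ such that (a) every vertex of $G$ belongs to at most three members of $\mathcal{Q}$, and every edge of $G$ belongs to exactly one member of $\mathcal{Q}$; (b) letting $W\subseteq V(G)$ be the set of vertices belonging to exactly three members of $\mathcal{Q}$, there is a mapping $W\to\mathcal{Q}$, $v\mapsto Q_v$, such that (b1) $v\in Q_v$ for all $v\in W$, and (b2) for all $u,v\in W$: if $u\in Q_v$ then $Q_u=Q_v$, and if $u\notin Q_v$ then $Q_u\cap Q_v=\emptyset$.
   Context: All graphs are finite and simple. An edge coloring of a graph $H$ is a map $\phi:E(H)\to\mathcal{C}$; it is proper if any two distinct edges sharing an endvertex get different colors. For an edge-colored graph $(H,\phi)$, the color-line graph $\mathrm{CL}(H)$ has vertex set $E(H)$, two distinct vertices being adjacent iff the corresponding edges of $H$ share an endvertex or have the same color. A graph $G$ is a proper color-line graph if it is isomorphic to $\mathrm{CL}(H)$ for some graph $H$ with a proper edge coloring. A clique is a set of pairwise adjacent vertices; an edge $uv$ belongs to a clique $Q$ if $u,v\in Q$. -}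

module Defs where

open import Data.Nat using (ℕ; _≤_)
open import Data.Fin using (Fin) renaming (_<_ to _<ᶠ_)
open import Data.Fin.Subset using (Subset; _∈_; _∉_; _∩_; Empty; ∣_∣)
open import Data.Bool using (Bool; true; false)
open import Data.Vec using (tabulate; lookup)
open import Data.Product using (Σ; _×_; ∃; Σ-syntax)
open import Data.Sum using (_⊎_)
open import Relation.Binary.PropositionalEquality using (_≡_; _≢_)
open import Function.Bundles using (_⤖_; Bijection; _⇔_)
open import Function.Definitions using (Injective)

record SimpleGraph (n : ℕ) : Set where
  field
    adj   : Fin n → Fin n → Bool
    sym   : ∀ u v → adj u v ≡ adj v u
    irrfl : ∀ v → adj v v ≡ false
open SimpleGraph public

Adj : ∀ {n} → SimpleGraph n → Fin n → Fin n → Set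
Adj G u v = adj G u v ≡ true

-- Edges of H: unordered pairs {x,y} of adjacent vertices, represented with x < y.
record Edge {m : ℕ} (H : SimpleGraph m) : Set where
  constructor edge
  field
    x   : Fin m
    y   : Fin m
    x<y : x <ᶠ y
    xy  : Adj H x y
open Edge public

ShareEnd : ∀ {m} {H : SimpleGraph m} → Edge H → Edge H → Set
ShareEnd e f = (x e ≡ x f ⊎ x e ≡ y f) ⊎ (y e ≡ x f ⊎ y e ≡ y f)

IsProperColoring : ∀ {m} (H : SimpleGraph m) {C : Set} → (Edge H → C) → Set
IsProperColoring H φ = ∀ e f → e ≢ f → ShareEnd e f → φ e ≢ φ f

CLAdj : ∀ {m} {H : SimpleGraph m} {C : Set} → (Edge H → C) → Edge H → Edge H → Set
CLAdj φ e f = e ≢ f × (ShareEnd e f ⊎ φ e ≡ φ f)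

IsoToCL : ∀ {n m} → SimpleGraph n → (H : SimpleGraph m) {C : Set} → (Edge H → C) → Set
IsoToCL G H φ = Σ[ f ∈ (Fin _ ⤖ Edge H) ]
  (∀ u v → Adj G u v ⇔ CLAdj φ (Bijection.to f u) (Bijection.to f v))

IsProperColorLineGraph : ∀ {n} → SimpleGraph n → Set₁
IsProperColorLineGraph G =
  Σ[ m ∈ ℕ ] Σ[ H ∈ SimpleGraph m ] Σ[ C ∈ Set ] Σ[ φ ∈ (Edge H → C) ]
    (IsProperColoring H φ × IsoToCL G H φ)

IsClique : ∀ {n} → SimpleGraph n → Subset n → Set
IsClique G S = ∀ u v → u ∈ S → v ∈ S → u ≢ v → Adj G u v

memberCount : ∀ {n k} → (Fin k → Subset n) → Fin n → ℕ
memberCount Q v = ∣ tabulate (λ i → lookup (Q i) v) ∣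

CliqueFamilyCondition : ∀ {n} → SimpleGraph n → Set
CliqueFamilyCondition {n} G =
  Σ[ k ∈ ℕ ] Σ[ Q ∈ (Fin k → Subset n) ]
    ( Injective _≡_ _≡_ Q
    × (∀ i → IsClique G (Q i))
    × (∀ v → memberCount Q v ≤ 3)
    × (∀ u v → Adj G u v →
         Σ[ i ∈ Fin k ] ((u ∈ Q i × v ∈ Q i)
                          × (∀ j → u ∈ Q j → v ∈ Q j → j ≡ i)))
    -- (b): W = vertices in exactly three members; a map W → Q
    × Σ[ σ ∈ ((v : Fin n) → memberCount Q v ≡ 3 → Fin k) ]
        ( (∀ v (wv : memberCount Q v ≡ 3) → v ∈ Q (σ v wv))
        × (∀ u v (wu : memberCount Q u ≡ 3) (wv : memberCount Q v ≡ 3) →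
             (u ∈ Q (σ v wv) → Q (σ u wu) ≡ Q (σ v wv))
           × (u ∉ Q (σ v wv) → Empty (Q (σ u wu) ∩ Q (σ v wv))))))

-- Forward: the colour classes and the stars of H are cliques of CL(H). Properness makes
-- "same colour" and "common end" exclusive, and two distinct edges of H share at most one
-- end, so every edge of CL(H) lies in exactly one of them; an edge of H lies only in its
-- colour class and the stars at its two ends, and σ picks the colour class.
-- Backward: the cliques in the image of σ become colour classes and all other cliques
-- ("lines") become vertices of H. A vertex of G lies on at most two lines, since three
-- would put it in W and σ v would be a fourth clique at it; so it becomes an edge of H
-- between its lines (padded with private spare vertices), coloured by its colour clique if
-- it has one and by a colour of its own otherwise.

module Submission where

open import Axiom.UniquenessOfIdentityProofs using (module Decidable⇒UIP)
open import Data.Bool using (Bool; true)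
import Data.Bool as Bool
open import Data.Empty using (⊥; ⊥-elim)
open import Data.Fin as Fin using (Fin; splitAt; join)
open import Data.Fin.Properties using (any?; <-cmp; splitAt-join)
open import Data.Fin.Subset using (Subset; inside; outside; _∈_; _∉_; _∪_; _∩_; _-_; ⁅_⁆; ⋃; Empty; ∣_∣)
open import Data.Fin.Subset.Properties
  using ( _∈?_; x∈p∩q⁺; x∈p∩q⁻; x∈p∪q⁺; x∈⁅x⁆; ∣⁅x⁆∣≡1; ∣⊥∣≡0; ∣p∣≤∣x∷p∣; p⊆q⇒∣p∣≤∣q∣
        ; x∈p∧x≢y⇒x∈p-y; x∈p⇒∣p-x∣<∣p∣)
open import Data.List using (List; []; _∷_; _++_; length; map; allFin; deduplicate)
import Data.List as List
open import Data.List.Membership.Propositional using () renaming (_∈_ to _∈ₗ_)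
open import Data.List.Membership.Propositional.Properties
  using (∈-map⁺; ∈-map⁻; ∈-++⁺ˡ; ∈-++⁺ʳ; ∈-++⁻; ∈-lookup; ∈-allFin; ∈-deduplicate⁻; ∈-deduplicate⁺)
open import Data.List.Relation.Unary.All as All using (All; []; _∷_)
open import Data.List.Relation.Unary.Any using (here; there; index)
open import Data.List.Relation.Unary.Any.Properties using (lookup-index)
open import Data.List.Relation.Unary.Unique.Propositional using (Unique; []; _∷_)
open import Data.List.Relation.Unary.Unique.DecPropositional.Properties using (deduplicate-!)
open import Data.Nat using (ℕ; _+_; _≤_; z≤n; s≤s)
open import Data.Nat.Properties
  using (≡-irrelevant; ≤-trans; ≤-reflexive; ≤-antisym; <-irrefl; <-asym; +-monoʳ-≤; +-mono-≤; +-suc; <-irrelevant)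
open import Data.Product using (∃-syntax; Σ-syntax; _×_; _,_; proj₁; proj₂)
import Data.Product as Product
open import Data.Sum using (_⊎_; inj₁; inj₂)
import Data.Sum as Sum
open import Data.Sum.Properties using (inj₁-injective; inj₂-injective)
open import Data.Vec using (tabulate; lookup)
import Data.Vec as Vec
open import Data.Vec.Properties using (lookup∘tabulate; tabulate-cong; []=⇒lookup; lookup⇒[]=; ≡-dec)
open import Function using (_∘_; id)
open import Function.Bundles using (_⤖_; Bijection; _⇔_; mk⤖; mk⇔; Equivalence)
open import Function.Consequences.Propositional using (strictlySurjective⇒surjective)
open import Function.Definitions using (Injective)
open import Level using (0ℓ)
open import Relation.Binary using (DecidableEquality; tri<; tri≈; tri>)
open import Relation.Binary.PropositionalEquality
open import Relation.Nullary using (¬_; Dec; yes; no; does; contradiction)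
open import Relation.Nullary.Decidable
  using (_×-dec_; _⊎-dec_; ¬?; dec-true; dec-false; does-⇔; decidable-stable)
open import Relation.Unary using (Pred; Decidable)

open import Defs hiding (sym)

∣p∪q∣≤∣p∣+∣q∣ : ∀ {n} (p q : Subset n) → ∣ p ∪ q ∣ ≤ ∣ p ∣ + ∣ q ∣
∣p∪q∣≤∣p∣+∣q∣ Vec.[]            Vec.[]            = z≤n
∣p∪q∣≤∣p∣+∣q∣ (inside  Vec.∷ p) (t       Vec.∷ q) =
  s≤s (≤-trans (∣p∪q∣≤∣p∣+∣q∣ p q) (+-monoʳ-≤ ∣ p ∣ (∣p∣≤∣x∷p∣ t q)))
∣p∪q∣≤∣p∣+∣q∣ (outside Vec.∷ p) (inside  Vec.∷ q) =
  ≤-trans (s≤s (∣p∪q∣≤∣p∣+∣q∣ p q)) (≤-reflexive (sym (+-suc ∣ p ∣ ∣ q ∣)))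
∣p∪q∣≤∣p∣+∣q∣ (outside Vec.∷ p) (outside Vec.∷ q) = ∣p∪q∣≤∣p∣+∣q∣ p q

module _ {n : ℕ} where

  ∈ₗ⇒∈⋃⁅⁆ : ∀ {i} {is : List (Fin n)} → i ∈ₗ is → i ∈ ⋃ (map ⁅_⁆ is)
  ∈ₗ⇒∈⋃⁅⁆ (here refl) = x∈p∪q⁺ (inj₁ (x∈⁅x⁆ _))
  ∈ₗ⇒∈⋃⁅⁆ (there i∈) = x∈p∪q⁺ (inj₂ (∈ₗ⇒∈⋃⁅⁆ i∈))

  ∣⋃⁅⁆∣≤length : (is : List (Fin n)) → ∣ ⋃ (map ⁅_⁆ is) ∣ ≤ length is
  ∣⋃⁅⁆∣≤length []       = ≤-reflexive (∣⊥∣≡0 n)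
  ∣⋃⁅⁆∣≤length (i ∷ is) =
    ≤-trans (∣p∪q∣≤∣p∣+∣q∣ ⁅ i ⁆ _) (+-mono-≤ (≤-reflexive (∣⁅x⁆∣≡1 i)) (∣⋃⁅⁆∣≤length is))

  ∣p∣≤length : ∀ (p : Subset n) (is : List (Fin n)) → (∀ {i} → i ∈ p → i ∈ₗ is) → ∣ p ∣ ≤ length is
  ∣p∣≤length p is p⊆is = ≤-trans (p⊆q⇒∣p∣≤∣q∣ (∈ₗ⇒∈⋃⁅⁆ ∘ p⊆is)) (∣⋃⁅⁆∣≤length is)

  length≤∣p∣ : ∀ {p : Subset n} {is : List (Fin n)} → Unique is → All (_∈ p) is → length is ≤ ∣ p ∣
  length≤∣p∣ []            []            = z≤n
  length≤∣p∣ {p} {i ∷ is} (i≢is ∷ unique) (i∈p ∷ is⊆p) =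
    ≤-trans (s≤s (length≤∣p∣ unique is⊆p-i)) (x∈p⇒∣p-x∣<∣p∣ i∈p)
    where
    is⊆p-i : All (_∈ p - i) is
    is⊆p-i = All.zipWith (λ (j∈p , i≢j) → x∈p∧x≢y⇒x∈p-y j∈p (i≢j ∘ sym)) (is⊆p , i≢is)

module _ {n : ℕ} {f : Fin n → Bool} {i : Fin n} where

  ∈-tabulate⁺ : f i ≡ true → i ∈ tabulate f
  ∈-tabulate⁺ fi = lookup⇒[]= i (tabulate f) (trans (lookup∘tabulate f i) fi)

  ∈-tabulate⁻ : i ∈ tabulate f → f i ≡ true
  ∈-tabulate⁻ i∈ = trans (sym (lookup∘tabulate f i)) ([]=⇒lookup i∈)

module _ {n : ℕ} {P : Pred (Fin n) 0ℓ} where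

  satisfying : Decidable P → Subset n
  satisfying P? = tabulate (does ∘ P?)

  ∈-satisfying⁺ : ∀ (P? : Decidable P) {i} → P i → i ∈ satisfying P?
  ∈-satisfying⁺ P? {i} p = ∈-tabulate⁺ (dec-true (P? i) p)

  ∈-satisfying⁻ : ∀ (P? : Decidable P) {i} → i ∈ satisfying P? → P i
  ∈-satisfying⁻ P? {i} i∈ with P? i | ∈-tabulate⁻ {f = does ∘ P?} i∈
  ... | yes p | _ = p

satisfying-cong : ∀ {n} {P R : Pred (Fin n) 0ℓ} (P? : Decidable P) (R? : Decidable R) →
                  (∀ i → P i ⇔ R i) → satisfying P? ≡ satisfying R?
satisfying-cong P? R? P⇔R = tabulate-cong (λ i → does-⇔ (P⇔R i) (P? i) (R? i))

containing : ∀ {n k} → (Fin k → Subset n) → Fin n → Subset k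
containing Q v = tabulate (λ i → lookup (Q i) v)

module _ {n k} (Q : Fin k → Subset n) {v : Fin n} {i : Fin k} where

  ∈-containing⁺ : v ∈ Q i → i ∈ containing Q v
  ∈-containing⁺ v∈ = ∈-tabulate⁺ ([]=⇒lookup v∈)

  ∈-containing⁻ : i ∈ containing Q v → v ∈ Q i
  ∈-containing⁻ i∈ = lookup⇒[]= v (Q i) (∈-tabulate⁻ i∈)

Adj⇒≢ : ∀ {n} (G : SimpleGraph n) {u v} → Adj G u v → u ≢ v
Adj⇒≢ G {u} uv refl = contradiction (trans (sym uv) (irrfl G u)) λ ()

module Edges {m : ℕ} (H : SimpleGraph m) where

  Incident : Fin m → Edge H → Set
  Incident z e = z ≡ x e ⊎ z ≡ y e

  incident? : ∀ z e → Dec (Incident z e)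
  incident? z e = (z Fin.≟ x e) ⊎-dec (z Fin.≟ y e)

  Edge-≡ : ∀ {e f : Edge H} → x e ≡ x f → y e ≡ y f → e ≡ f
  Edge-≡ {edge s t s<t st} {edge .s .t s<t′ st′} refl refl
    rewrite <-irrelevant s<t s<t′ | Decidable⇒UIP.≡-irrelevant Bool._≟_ st st′ = refl

  ShareEnd⇒incident : ∀ (e f : Edge H) → ShareEnd e f → ∃[ z ] Incident z e × Incident z f
  ShareEnd⇒incident _ _ (inj₁ xe≡) = _ , inj₁ refl , xe≡
  ShareEnd⇒incident _ _ (inj₂ ye≡) = _ , inj₂ refl , ye≡

  incident⇒ShareEnd : ∀ {z} (e f : Edge H) → Incident z e → Incident z f → ShareEnd e f
  incident⇒ShareEnd _ _ (inj₁ refl) z∈f = inj₁ z∈f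
  incident⇒ShareEnd _ _ (inj₂ refl) z∈f = inj₂ z∈f

  shareEnd? : ∀ e f → Dec (ShareEnd e f)
  shareEnd? e f = incident? (x e) f ⊎-dec incident? (y e) f

  orientation : ∀ {a b} (e : Edge H) → a ≢ b → Incident a e → Incident b e →
                (x e ≡ a × y e ≡ b) ⊎ (x e ≡ b × y e ≡ a)
  orientation e a≢b (inj₁ refl) (inj₁ refl) = contradiction refl a≢b
  orientation e a≢b (inj₁ refl) (inj₂ refl) = inj₁ (refl , refl)
  orientation e a≢b (inj₂ refl) (inj₁ refl) = inj₂ (refl , refl)
  orientation e a≢b (inj₂ refl) (inj₂ refl) = contradiction refl a≢b

  incident-determines : ∀ {a b} (e f : Edge H) → a ≢ b →
                        Incident a e → Incident b e → Incident a f → Incident b f → e ≡ f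
  incident-determines e f a≢b ae be af bf with orientation e a≢b ae be | orientation f a≢b af bf
  ... | inj₁ (refl , refl) | inj₁ (xf , yf) = Edge-≡ (sym xf) (sym yf)
  ... | inj₂ (refl , refl) | inj₂ (xf , yf) = Edge-≡ (sym xf) (sym yf)
  ... | inj₁ (refl , refl) | inj₂ (refl , refl) = contradiction (x<y e) (<-asym (x<y f))
  ... | inj₂ (refl , refl) | inj₁ (refl , refl) = contradiction (x<y e) (<-asym (x<y f))

  edgeBetween : ∀ {s t} → Adj H s t → Edge H
  edgeBetween {s} {t} st with <-cmp s t
  ... | tri< s<t _ _ = edge s t s<t st
  ... | tri≈ _ s≡t _ = contradiction s≡t (Adj⇒≢ H st)
  ... | tri> _ _ t<s = edge t s t<s (trans (SimpleGraph.sym H t s) st)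

  incident-edgeBetween⁺ : ∀ {s t z} (st : Adj H s t) → z ≡ s ⊎ z ≡ t → Incident z (edgeBetween st)
  incident-edgeBetween⁺ {s} {t} st z≡ with <-cmp s t
  ... | tri< _ _ _ = z≡
  ... | tri≈ _ s≡t _ = contradiction s≡t (Adj⇒≢ H st)
  ... | tri> _ _ _ = Sum.swap z≡

  incident-edgeBetween⁻ : ∀ {s t z} (st : Adj H s t) → Incident z (edgeBetween st) → z ≡ s ⊎ z ≡ t
  incident-edgeBetween⁻ {s} {t} st z∈ with <-cmp s t
  ... | tri< _ _ _ = z∈
  ... | tri≈ _ s≡t _ = contradiction s≡t (Adj⇒≢ H st)
  ... | tri> _ _ _ = Sum.swap z∈

lookup-injective : ∀ {A : Set} {xs : List A} → Unique xs → Injective _≡_ _≡_ (List.lookup xs)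
lookup-injective (_ ∷ _)       {Fin.zero}  {Fin.zero}  _  = refl
lookup-injective (x∉xs ∷ _)    {Fin.zero}  {Fin.suc j} x≡ = contradiction x≡ (All.lookup x∉xs (∈-lookup j))
lookup-injective (x∉xs ∷ _)    {Fin.suc i} {Fin.zero}  ≡x = contradiction (sym ≡x) (All.lookup x∉xs (∈-lookup i))
lookup-injective (_ ∷ unique) {Fin.suc i} {Fin.suc j} eq = cong Fin.suc (lookup-injective unique eq)

module Enumeration {A : Set} (_≟_ : DecidableEquality A) (xs : List A) where

  distinct : List A
  distinct = deduplicate _≟_ xs

  size : ℕ
  size = length distinct

  member : Fin size → A
  member = List.lookup distinct

  member-injective : Injective _≡_ _≡_ member
  member-injective = lookup-injective (deduplicate-! _≟_ xs)

  member-∈ : ∀ i → member i ∈ₗ xs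
  member-∈ i = ∈-deduplicate⁻ _≟_ xs (∈-lookup i)

  indexOf : ∀ {a} → a ∈ₗ xs → Fin size
  indexOf a∈ = index (∈-deduplicate⁺ _≟_ a∈)

  member-indexOf : ∀ {a} (a∈ : a ∈ₗ xs) → member (indexOf a∈) ≡ a
  member-indexOf a∈ = sym (lookup-index (∈-deduplicate⁺ _≟_ a∈))

module FromColourLineGraph {n m : ℕ} (G : SimpleGraph n) (H : SimpleGraph m) {C : Set} (φ : Edge H → C)
  (proper : IsProperColoring H φ) (f : Fin n ⤖ Edge H)
  (iso : ∀ u v → Adj G u v ⇔ CLAdj φ (Bijection.to f u) (Bijection.to f v)) where

  open Bijection f using (to; injective)
  open Edges H

  adj⁺ : ∀ {u v} → u ≢ v → ShareEnd (to u) (to v) ⊎ φ (to u) ≡ φ (to v) → Adj G u v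
  adj⁺ {u} {v} u≢v cl = Equivalence.from (iso u v) (u≢v ∘ injective , cl)

  SameColour : Fin n → Fin n → Set
  SameColour u v = φ (to u) ≡ φ (to v)

  -- C need not have decidable equality, but for distinct non-incident edges,
  -- having the same colour is exactly adjacency in G.
  sameColour? : ∀ u v → Dec (SameColour u v)
  sameColour? u v with u Fin.≟ v
  ... | yes refl = yes refl
  ... | no u≢v with shareEnd? (to u) (to v)
  ...   | yes shared = no (proper (to u) (to v) (u≢v ∘ injective) shared)
  ...   | no unshared with adj G u v Bool.≟ true
  ...     | yes uv = yes (Sum.fromInj₂ (λ shared → contradiction shared unshared) (proj₂ (Equivalence.to (iso u v) uv)))
  ...     | no ¬uv = no (¬uv ∘ adj⁺ u≢v ∘ inj₂)

  colourClass : Fin n → Subset n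
  colourClass v = satisfying (λ u → sameColour? u v)

  star : Fin m → Subset n
  star z = satisfying (λ u → incident? z (to u))

  ∈colourClass⁺ : ∀ {u v} → SameColour u v → u ∈ colourClass v
  ∈colourClass⁺ {v = v} = ∈-satisfying⁺ (λ u → sameColour? u v)

  ∈colourClass⁻ : ∀ {u v} → u ∈ colourClass v → SameColour u v
  ∈colourClass⁻ {v = v} = ∈-satisfying⁻ (λ u → sameColour? u v)

  ∈star⁺ : ∀ {u z} → Incident z (to u) → u ∈ star z
  ∈star⁺ {z = z} = ∈-satisfying⁺ (λ u → incident? z (to u))

  ∈star⁻ : ∀ {u z} → u ∈ star z → Incident z (to u)
  ∈star⁻ {z = z} = ∈-satisfying⁻ (λ u → incident? z (to u))

  colourClass-cong : ∀ {u v} → SameColour u v → colourClass u ≡ colourClass v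
  colourClass-cong {u} {v} uv = satisfying-cong (λ w → sameColour? w u) (λ w → sameColour? w v)
                                                (λ w → mk⇔ (λ wu → trans wu uv) (λ wv → trans wv (sym uv)))

  cliques : List (Subset n)
  cliques = map colourClass (allFin n) ++ map star (allFin m)

  open Enumeration (≡-dec Bool._≟_) cliques renaming (size to k; member to Q; member-injective to Q-injective)

  colourClique : Fin n → Fin k
  colourClique v = indexOf (∈-++⁺ˡ (∈-map⁺ colourClass (∈-allFin v)))

  starClique : Fin m → Fin k
  starClique z = indexOf (∈-++⁺ʳ (map colourClass (allFin n)) (∈-map⁺ star (∈-allFin z)))

  Q-colourClique : ∀ v → Q (colourClique v) ≡ colourClass v
  Q-colourClique v = member-indexOf _

  Q-starClique : ∀ z → Q (starClique z) ≡ star z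
  Q-starClique z = member-indexOf _

  ∈colourClique⁺ : ∀ {w v} → SameColour w v → w ∈ Q (colourClique v)
  ∈colourClique⁺ {w} {v} wv = subst (w ∈_) (sym (Q-colourClique v)) (∈colourClass⁺ wv)

  ∈colourClique⁻ : ∀ {w v} → w ∈ Q (colourClique v) → SameColour w v
  ∈colourClique⁻ {w} {v} w∈ = ∈colourClass⁻ (subst (w ∈_) (Q-colourClique v) w∈)

  ∈starClique⁺ : ∀ {w z} → Incident z (to w) → w ∈ Q (starClique z)
  ∈starClique⁺ {w} {z} zw = subst (w ∈_) (sym (Q-starClique z)) (∈star⁺ zw)

  Q-cases : ∀ j → (∃[ w ] Q j ≡ colourClass w) ⊎ (∃[ z ] Q j ≡ star z)
  Q-cases j with ∈-++⁻ (map colourClass (allFin n)) (member-∈ j)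
  ... | inj₁ ∈colours = let w , _ , eq = ∈-map⁻ colourClass ∈colours in inj₁ (w , eq)
  ... | inj₂ ∈stars   = let z , _ , eq = ∈-map⁻ star ∈stars in inj₂ (z , eq)

  sharedClique : ∀ {u v j} → u ∈ Q j → v ∈ Q j →
                 (SameColour u v × j ≡ colourClique u)
                 ⊎ (∃[ z ] Incident z (to u) × Incident z (to v) × j ≡ starClique z)
  sharedClique {u} {v} {j} u∈ v∈ with Q-cases j
  ... | inj₁ (w , Qj≡) =
    let uw = ∈colourClass⁻ (subst (u ∈_) Qj≡ u∈)
        vw = ∈colourClass⁻ (subst (v ∈_) Qj≡ v∈)
    in inj₁ (trans uw (sym vw)
            , Q-injective (trans Qj≡ (trans (colourClass-cong (sym uw)) (sym (Q-colourClique u)))))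
  ... | inj₂ (z , Qj≡) =
    inj₂ (z , ∈star⁻ (subst (u ∈_) Qj≡ u∈) , ∈star⁻ (subst (v ∈_) Qj≡ v∈)
            , Q-injective (trans Qj≡ (sym (Q-starClique z))))

  isClique : ∀ j → IsClique G (Q j)
  isClique j u v u∈ v∈ u≢v with sharedClique u∈ v∈
  ... | inj₁ (uv , _)          = adj⁺ u≢v (inj₂ uv)
  ... | inj₂ (z , zu , zv , _) = adj⁺ u≢v (inj₁ (incident⇒ShareEnd (to u) (to v) zu zv))

  memberCount≤3 : ∀ v → memberCount Q v ≤ 3
  memberCount≤3 v = ∣p∣≤length (containing Q v) own among
    where
    own : List (Fin k)
    own = colourClique v ∷ starClique (x (to v)) ∷ starClique (y (to v)) ∷ []
    among : ∀ {j} → j ∈ containing Q v → j ∈ₗ own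
    among {j} j∈ with v∈Qj ← ∈-containing⁻ Q {v} j∈ | sharedClique v∈Qj v∈Qj
    ... | inj₁ (_ , refl)                 = here refl
    ... | inj₂ (_ , inj₁ refl , _ , refl) = there (here refl)
    ... | inj₂ (_ , inj₂ refl , _ , refl) = there (there (here refl))

  uniqueClique : ∀ u v → Adj G u v →
                 Σ[ i ∈ Fin k ] ((u ∈ Q i × v ∈ Q i) × (∀ j → u ∈ Q j → v ∈ Q j → j ≡ i))
  uniqueClique u v uv with Equivalence.to (iso u v) uv
  ... | e≢f , inj₁ shared =
    let z , zu , zv = ShareEnd⇒incident (to u) (to v) shared
    in starClique z , (∈starClique⁺ zu , ∈starClique⁺ zv) , unique z zu zv
    where
    unique : ∀ z → Incident z (to u) → Incident z (to v) → ∀ j → u ∈ Q j → v ∈ Q j → j ≡ starClique z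
    unique z zu zv j u∈ v∈ with sharedClique u∈ v∈
    ... | inj₁ (same , _) = contradiction same (proper _ _ e≢f shared)
    ... | inj₂ (z′ , z′u , z′v , refl) with z′ Fin.≟ z
    ...   | yes refl = refl
    ...   | no z′≢z  = contradiction (incident-determines (to u) (to v) z′≢z z′u zu z′v zv) e≢f
  ... | e≢f , inj₂ same =
    colourClique u , (∈colourClique⁺ refl , ∈colourClique⁺ (sym same)) , unique
    where
    unique : ∀ j → u ∈ Q j → v ∈ Q j → j ≡ colourClique u
    unique j u∈ v∈ with sharedClique u∈ v∈
    ... | inj₁ (_ , j≡)           = j≡
    ... | inj₂ (_ , zu , zv , _) = contradiction same (proper _ _ e≢f (incident⇒ShareEnd (to u) (to v) zu zv))

  σ : (v : Fin n) → memberCount Q v ≡ 3 → Fin k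
  σ v _ = colourClique v

  v∈σv : ∀ v (wv : memberCount Q v ≡ 3) → v ∈ Q (σ v wv)
  v∈σv v _ = ∈colourClique⁺ refl

  σ-related : ∀ u v (wu : memberCount Q u ≡ 3) (wv : memberCount Q v ≡ 3) →
              (u ∈ Q (σ v wv) → Q (σ u wu) ≡ Q (σ v wv))
            × (u ∉ Q (σ v wv) → Empty (Q (σ u wu) ∩ Q (σ v wv)))
  σ-related u v _ _ = same , disjoint
    where
    same : u ∈ Q (colourClique v) → Q (colourClique u) ≡ Q (colourClique v)
    same u∈ = trans (Q-colourClique u) (trans (colourClass-cong (∈colourClique⁻ u∈)) (sym (Q-colourClique v)))
    disjoint : u ∉ Q (colourClique v) → Empty (Q (colourClique u) ∩ Q (colourClique v))
    disjoint u∉ (w , w∈) =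
      let w∈u , w∈v = x∈p∩q⁻ _ _ w∈
      in u∉ (∈colourClique⁺ (trans (sym (∈colourClique⁻ w∈u)) (∈colourClique⁻ w∈v)))

  cliqueFamily : CliqueFamilyCondition G
  cliqueFamily = k , Q , Q-injective , isClique , memberCount≤3 , uniqueClique , σ , v∈σv , σ-related

module FromCliqueFamily {n : ℕ} (G : SimpleGraph n) (k : ℕ) (Q : Fin k → Subset n)
  (Q-injective : Injective _≡_ _≡_ Q)
  (isClique : ∀ i → IsClique G (Q i))
  (memberCount≤3 : ∀ v → memberCount Q v ≤ 3)
  (uniqueClique : ∀ u v → Adj G u v →
     Σ[ i ∈ Fin k ] ((u ∈ Q i × v ∈ Q i) × (∀ j → u ∈ Q j → v ∈ Q j → j ≡ i)))
  (σ : (v : Fin n) → memberCount Q v ≡ 3 → Fin k)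
  (v∈σv : ∀ v (wv : memberCount Q v ≡ 3) → v ∈ Q (σ v wv))
  (σ-related : ∀ u v (wu : memberCount Q u ≡ 3) (wv : memberCount Q v ≡ 3) →
     (u ∈ Q (σ v wv) → Q (σ u wu) ≡ Q (σ v wv))
   × (u ∉ Q (σ v wv) → Empty (Q (σ u wu) ∩ Q (σ v wv))))
  where

  sameClique : ∀ {u v i j} → u ≢ v → u ∈ Q i → v ∈ Q i → u ∈ Q j → v ∈ Q j → i ≡ j
  sameClique {u} {v} {i} {j} u≢v u∈i v∈i u∈j v∈j =
    let _ , _ , unique = uniqueClique u v (isClique i u v u∈i v∈i u≢v)
    in trans (unique i u∈i v∈i) (sym (unique j u∈j v∈j))

  IsColour : Fin k → Set
  IsColour i = ∃[ w ] Σ[ w∈W ∈ memberCount Q w ≡ 3 ] σ w w∈W ≡ i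

  isColour? : ∀ i → Dec (IsColour i)
  isColour? i = any? λ w → decσ w
    where
    decσ : ∀ w → Dec (Σ[ w∈W ∈ memberCount Q w ≡ 3 ] σ w w∈W ≡ i)
    decσ w with memberCount Q w Data.Nat.≟ 3
    ... | no ¬w∈W = no (¬w∈W ∘ proj₁)
    ... | yes w∈W with σ w w∈W Fin.≟ i
    ...   | yes σw≡i = yes (w∈W , σw≡i)
    ...   | no σw≢i  = no λ (w∈W′ , σw≡i) →
                       σw≢i (subst (λ w∈W″ → σ w w∈W″ ≡ i) (≡-irrelevant w∈W′ w∈W) σw≡i)

  colour-unique : ∀ {i j v} → IsColour i → IsColour j → v ∈ Q i → v ∈ Q j → i ≡ j
  colour-unique {v = v} (w , w∈W , refl) (u , u∈W , refl) v∈i v∈j with w ∈? Q (σ u u∈W)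
  ... | yes w∈ = Q-injective (proj₁ (σ-related w u w∈W u∈W) w∈)
  ... | no w∉  = contradiction (v , x∈p∩q⁺ (v∈i , v∈j)) (proj₂ (σ-related w u w∈W u∈W) w∉)

  Line : Fin n → Fin k → Set
  Line v i = v ∈ Q i × ¬ IsColour i

  line? : ∀ v i → Dec (Line v i)
  line? v i = (v ∈? Q i) ×-dec ¬? (isColour? i)

  -- Three lines through v force v ∈ W, and then σ v is a fourth clique at v.
  at-most-two-lines : ∀ {v a b c} → Line v a → Line v b → Line v c → a ≢ b → a ≢ c → b ≢ c → ⊥
  at-most-two-lines {v} {a} {b} {c} (v∈a , ¬a) (v∈b , ¬b) (v∈c , ¬c) a≢b a≢c b≢c =
    <-irrefl refl (≤-trans four≤ (memberCount≤3 v))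
    where
    three≤ : 3 ≤ memberCount Q v
    three≤ = length≤∣p∣ ((a≢b ∷ a≢c ∷ []) ∷ (b≢c ∷ []) ∷ [] ∷ [])
                        (∈-containing⁺ Q v∈a ∷ ∈-containing⁺ Q v∈b ∷ ∈-containing⁺ Q v∈c ∷ [])
    v∈W : memberCount Q v ≡ 3
    v∈W = ≤-antisym (memberCount≤3 v) three≤
    s = σ v v∈W
    s-colour : IsColour s
    s-colour = v , v∈W , refl
    s≢ : ∀ {i} → ¬ IsColour i → s ≢ i
    s≢ ¬i s≡i = ¬i (subst IsColour s≡i s-colour)
    four≤ : 4 ≤ memberCount Q v
    four≤ = length≤∣p∣ ((s≢ ¬a ∷ s≢ ¬b ∷ s≢ ¬c ∷ []) ∷ (a≢b ∷ a≢c ∷ []) ∷ (b≢c ∷ []) ∷ [] ∷ [])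
                       (∈-containing⁺ Q (v∈σv v v∈W) ∷ ∈-containing⁺ Q v∈a
                         ∷ ∈-containing⁺ Q v∈b ∷ ∈-containing⁺ Q v∈c ∷ [])

  -- Vertices of H: one per clique of the family, and two spare vertices owned by each vertex of G.
  Label : Set
  Label = Fin k ⊎ (Fin n ⊎ Fin n)

  m : ℕ
  m = k + (n + n)

  opaque
    vertex : Label → Fin m
    vertex = join k (n + n) ∘ Sum.map₂ (join n n)

    vertex-injective : Injective _≡_ _≡_ vertex
    vertex-injective {a} {b} eq =
      trans (sym (decode-vertex a)) (trans (cong decode eq) (decode-vertex b))
      where
      decode : Fin m → Label
      decode = Sum.map₂ (splitAt n) ∘ splitAt k
      decode-vertex : ∀ l → decode (vertex l) ≡ l
      decode-vertex (inj₁ i) rewrite splitAt-join k (n + n) (inj₁ i) = refl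
      decode-vertex (inj₂ s) rewrite splitAt-join k (n + n) (inj₂ (join n n s)) | splitAt-join n n s = refl

  EndLabel : Fin n → Label → Set
  EndLabel v (inj₁ i) = Line v i
  EndLabel v (inj₂ s) = Sum.[ id , id ]′ s ≡ v

  record Ends (v : Fin n) : Set where
    field
      a b      : Label
      a≢b      : a ≢ b
      a-end    : EndLabel v a
      b-end    : EndLabel v b
      lines⊆ab : ∀ {i} → Line v i → inj₁ i ≡ a ⊎ inj₁ i ≡ b

  opaque
    ends : ∀ v → Ends v
    ends v with any? (line? v)
    ... | no noLine = record
      { a = inj₂ (inj₁ v) ; b = inj₂ (inj₂ v) ; a≢b = λ () ; a-end = refl ; b-end = refl
      ; lines⊆ab = λ {i} l → contradiction (i , l) noLine }
    ... | yes (i , lᵢ) with any? (λ j → line? v j ×-dec ¬? (j Fin.≟ i))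
    ...   | no noOther = record
      { a = inj₁ i ; b = inj₂ (inj₁ v) ; a≢b = λ () ; a-end = lᵢ ; b-end = refl
      ; lines⊆ab = λ {j} lⱼ →
          inj₁ (cong inj₁ (decidable-stable (j Fin.≟ i) (λ j≢i → noOther (j , lⱼ , j≢i)))) }
    ...   | yes (j , lⱼ , j≢i) = record
      { a = inj₁ i ; b = inj₁ j ; a≢b = j≢i ∘ sym ∘ inj₁-injective ; a-end = lᵢ ; b-end = lⱼ
      ; lines⊆ab = λ {l} lₗ → Sum.map (cong inj₁) (cong inj₁) (third l lₗ) }
      where
      third : ∀ l → Line v l → l ≡ i ⊎ l ≡ j
      third l lₗ with l Fin.≟ i | l Fin.≟ j
      ... | yes l≡i | _       = inj₁ l≡i
      ... | no _    | yes l≡j = inj₂ l≡j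
      ... | no l≢i  | no l≢j  = ⊥-elim (at-most-two-lines lᵢ lⱼ lₗ (j≢i ∘ sym) (l≢i ∘ sym) (l≢j ∘ sym))

  p q : Fin n → Fin m
  p v = vertex (Ends.a (ends v))
  q v = vertex (Ends.b (ends v))

  p≢q : ∀ v → p v ≢ q v
  p≢q v = Ends.a≢b (ends v) ∘ vertex-injective

  Joined : Fin m → Fin m → Set
  Joined s t = ∃[ v ] ((s ≡ p v × t ≡ q v) ⊎ (s ≡ q v × t ≡ p v))

  opaque
    joined? : ∀ s t → Dec (Joined s t)
    joined? s t = any? λ v → ((s Fin.≟ p v) ×-dec (t Fin.≟ q v)) ⊎-dec ((s Fin.≟ q v) ×-dec (t Fin.≟ p v))

  Joined-sym : ∀ {s t} → Joined s t → Joined t s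
  Joined-sym (v , st) = v , Sum.swap (Sum.map Product.swap Product.swap st)

  Joined-irrefl : ∀ {s} → ¬ Joined s s
  Joined-irrefl (v , inj₁ (refl , s≡q)) = p≢q v s≡q
  Joined-irrefl (v , inj₂ (refl , s≡p)) = p≢q v (sym s≡p)

  H : SimpleGraph m
  H = record
    { adj   = λ s t → does (joined? s t)
    ; sym   = λ s t → does-⇔ (mk⇔ Joined-sym Joined-sym) (joined? s t) (joined? t s)
    ; irrfl = λ s → dec-false (joined? s s) Joined-irrefl
    }

  open Edges H

  pq-adjacent : ∀ v → Adj H (p v) (q v)
  pq-adjacent v = dec-true (joined? (p v) (q v)) (v , inj₁ (refl , refl))

  opaque
    toE : Fin n → Edge H
    toE v = edgeBetween (pq-adjacent v)

    incident-toE⁺ : ∀ {z v} → z ≡ p v ⊎ z ≡ q v → Incident z (toE v)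
    incident-toE⁺ {v = v} = incident-edgeBetween⁺ (pq-adjacent v)

    incident-toE⁻ : ∀ {z v} → Incident z (toE v) → z ≡ p v ⊎ z ≡ q v
    incident-toE⁻ {v = v} = incident-edgeBetween⁻ (pq-adjacent v)

  p-incident : ∀ v → Incident (p v) (toE v)
  p-incident v = incident-toE⁺ (inj₁ refl)

  q-incident : ∀ v → Incident (q v) (toE v)
  q-incident v = incident-toE⁺ (inj₂ refl)

  line-incident : ∀ {v i} → Line v i → Incident (vertex (inj₁ i)) (toE v)
  line-incident {v} l = incident-toE⁺ (Sum.map (cong vertex) (cong vertex) (Ends.lines⊆ab (ends v) l))

  incident-toE⇒end : ∀ {z v} → Incident z (toE v) → ∃[ l ] z ≡ vertex l × EndLabel v l
  incident-toE⇒end {v = v} z∈ with incident-toE⁻ z∈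
  ... | inj₁ z≡p = _ , z≡p , Ends.a-end (ends v)
  ... | inj₂ z≡q = _ , z≡q , Ends.b-end (ends v)

  sharedEnd⇒line : ∀ {z u v} → u ≢ v → Incident z (toE u) → Incident z (toE v) →
                   ∃[ i ] z ≡ vertex (inj₁ i) × Line u i × Line v i
  sharedEnd⇒line {z} {u} {v} u≢v zu zv
    with l , z≡l , lu ← incident-toE⇒end zu | l′ , z≡l′ , lv ← incident-toE⇒end zv
    with refl ← vertex-injective {l} {l′} (trans (sym z≡l) z≡l′) = shared l z≡l lu lv
    where
    shared : ∀ l → z ≡ vertex l → EndLabel u l → EndLabel v l → ∃[ i ] z ≡ vertex (inj₁ i) × Line u i × Line v i
    shared (inj₁ i) z≡ lu lv = i , z≡ , lu , lv
    shared (inj₂ _) _  lu lv = contradiction (trans (sym lu) lv) u≢v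

  -- Distinct u, v with the same edge would lie on two common lines, one at each end.
  toE-injective : Injective _≡_ _≡_ toE
  toE-injective {u} {v} eq with u Fin.≟ v
  ... | yes u≡v = u≡v
  ... | no u≢v =
    let i , p≡i , (u∈i , _) , (v∈i , _) = sharedEnd⇒line u≢v (p-incident u) (subst (Incident (p u)) eq (p-incident u))
        j , q≡j , (u∈j , _) , (v∈j , _) = sharedEnd⇒line u≢v (q-incident u) (subst (Incident (q u)) eq (q-incident u))
    in ⊥-elim (p≢q u (trans p≡i (trans (cong (vertex ∘ inj₁) (sameClique u≢v u∈i v∈i u∈j v∈j)) (sym q≡j))))

  toE-surjective : ∀ e → ∃[ v ] toE v ≡ e
  toE-surjective e with joined? (x e) (y e) | xy e
  ... | yes (v , inj₁ (x≡p , y≡q)) | _ =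
    v , incident-determines (toE v) e (p≢q v) (p-incident v) (q-incident v) (inj₁ (sym x≡p)) (inj₂ (sym y≡q))
  ... | yes (v , inj₂ (x≡q , y≡p)) | _ =
    v , incident-determines (toE v) e (p≢q v) (p-incident v) (q-incident v) (inj₂ (sym y≡p)) (inj₁ (sym x≡q))

  from : Edge H → Fin n
  from e = proj₁ (toE-surjective e)

  toE-from : ∀ e → toE (from e) ≡ e
  toE-from e = proj₂ (toE-surjective e)

  from-toE : ∀ v → from (toE v) ≡ v
  from-toE v = toE-injective (toE-from (toE v))

  opaque
    colour : Fin n → Fin k ⊎ Fin n
    colour v with any? (λ i → (v ∈? Q i) ×-dec isColour? i)
    ... | yes (i , _) = inj₁ i
    ... | no _        = inj₂ v

    colour-spec : ∀ v → (∃[ i ] colour v ≡ inj₁ i × v ∈ Q i × IsColour i)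
                      ⊎ (colour v ≡ inj₂ v × ∀ {i} → v ∈ Q i → ¬ IsColour i)
    colour-spec v with any? (λ i → (v ∈? Q i) ×-dec isColour? i)
    ... | yes (i , v∈i , cᵢ) = inj₁ (i , refl , v∈i , cᵢ)
    ... | no none            = inj₂ (refl , λ {i} v∈i cᵢ → none (i , v∈i , cᵢ))

  colour-of-clique : ∀ {v i} → v ∈ Q i → IsColour i → colour v ≡ inj₁ i
  colour-of-clique {v} v∈i cᵢ with colour-spec v
  ... | inj₁ (j , cv≡j , v∈j , cⱼ) = trans cv≡j (cong inj₁ (colour-unique cⱼ cᵢ v∈j v∈i))
  ... | inj₂ (_ , uncoloured)      = contradiction cᵢ (uncoloured v∈i)

  sameColour⇒colourClique : ∀ {u v} → u ≢ v → colour u ≡ colour v → ∃[ i ] u ∈ Q i × v ∈ Q i × IsColour i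
  sameColour⇒colourClique {u} {v} u≢v same with colour-spec u | colour-spec v
  ... | inj₁ (i , cu≡i , u∈i , cᵢ) | inj₁ (j , cv≡j , v∈j , _) =
    i , u∈i , subst (λ c → v ∈ Q c) (inj₁-injective (trans (sym cv≡j) (trans (sym same) cu≡i))) v∈j , cᵢ
  ... | inj₁ (i , cu≡i , _) | inj₂ (cv≡v , _) = contradiction (trans (sym cu≡i) (trans same cv≡v)) λ ()
  ... | inj₂ (cu≡u , _) | inj₁ (j , cv≡j , _) = contradiction (trans (sym cu≡u) (trans same cv≡j)) λ ()
  ... | inj₂ (cu≡u , _) | inj₂ (cv≡v , _)     = contradiction (inj₂-injective (trans (sym cu≡u) (trans same cv≡v))) u≢v

  φ : Edge H → Fin k ⊎ Fin n
  φ e = colour (from e)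

  φ-toE : ∀ v → φ (toE v) ≡ colour v
  φ-toE v = cong colour (from-toE v)

  -- A common end gives a line through u and v, an equal colour a colour clique through them:
  -- two different cliques containing the edge uv of G.
  shareEnd⇒colour≢ : ∀ {u v} → u ≢ v → ShareEnd (toE u) (toE v) → colour u ≢ colour v
  shareEnd⇒colour≢ {u} {v} u≢v shared same =
    let z , zu , zv                     = ShareEnd⇒incident (toE u) (toE v) shared
        i , _ , (u∈i , ¬cᵢ) , (v∈i , _) = sharedEnd⇒line u≢v zu zv
        j , u∈j , v∈j , cⱼ               = sameColour⇒colourClique u≢v same
    in ¬cᵢ (subst IsColour (sameClique u≢v u∈j v∈j u∈i v∈i) cⱼ)

  proper : IsProperColoring H φ
  proper e f e≢f shared =
    shareEnd⇒colour≢ (λ u≡v → e≢f (trans (sym (toE-from e)) (trans (cong toE u≡v) (toE-from f))))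
                     (subst₂ ShareEnd (sym (toE-from e)) (sym (toE-from f)) shared)

  iso : ∀ u v → Adj G u v ⇔ CLAdj φ (toE u) (toE v)
  iso u v = mk⇔ adjacent⇒CLAdj CLAdj⇒adjacent
    where
    φ-colour : ∀ {w i} → w ∈ Q i → IsColour i → φ (toE w) ≡ inj₁ i
    φ-colour {w} w∈i cᵢ = trans (φ-toE w) (colour-of-clique w∈i cᵢ)
    adjacent⇒CLAdj : Adj G u v → CLAdj φ (toE u) (toE v)
    adjacent⇒CLAdj uv with uniqueClique u v uv
    ... | i , (u∈i , v∈i) , _ with isColour? i
    ...   | yes cᵢ = Adj⇒≢ G uv ∘ toE-injective ,
                     inj₂ (trans (φ-colour u∈i cᵢ) (sym (φ-colour v∈i cᵢ)))
    ...   | no ¬cᵢ = Adj⇒≢ G uv ∘ toE-injective ,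
                     inj₁ (incident⇒ShareEnd (toE u) (toE v) (line-incident (u∈i , ¬cᵢ)) (line-incident (v∈i , ¬cᵢ)))
    CLAdj⇒adjacent : CLAdj φ (toE u) (toE v) → Adj G u v
    CLAdj⇒adjacent (e≢f , inj₁ shared) =
      let z , zu , zv = ShareEnd⇒incident (toE u) (toE v) shared
          i , _ , (u∈i , _) , (v∈i , _) = sharedEnd⇒line (e≢f ∘ cong toE) zu zv
      in isClique i u v u∈i v∈i (e≢f ∘ cong toE)
    CLAdj⇒adjacent (e≢f , inj₂ same) =
      let i , u∈i , v∈i , _ =
            sameColour⇒colourClique (e≢f ∘ cong toE) (trans (sym (φ-toE u)) (trans same (φ-toE v)))
      in isClique i u v u∈i v∈i (e≢f ∘ cong toE)

  colourLineGraph : IsProperColorLineGraph G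
  colourLineGraph =
    m , H , (Fin k ⊎ Fin n) , φ , proper ,
    mk⤖ (toE-injective , strictlySurjective⇒surjective toE-surjective) , iso

theorem4 : ∀ {n : ℕ} (G : SimpleGraph n) → IsProperColorLineGraph G ⇔ CliqueFamilyCondition G
theorem4 G = mk⇔
  (λ (_ , H , _ , φ , proper , f , iso) → FromColourLineGraph.cliqueFamily G H φ proper f iso)
  (λ (k , Q , Q-inj , cliques , ≤3 , cover , σ , v∈σv , σ-rel) →
     FromCliqueFamily.colourLineGraph G k Q Q-inj cliques ≤3 cover σ v∈σv σ-rel)
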